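{- Let $q$ be a prime power which is a square, and let $U(4,q)$ be the unitary polar graph defined below. The weight-distribution bound is tight for the negative non-principal eigenvalue $\theta_2=-(\sqrt{q}+1)$ of $U(4,q)$; that is, there exists a function $f$ from the vertex set of $U(4,q)$ to $\mathbb{R}$, not identically zero, such that $\theta_2 f(\gamma)=\sum_{\delta\sim\gamma} f(\delta)$ for every vertex $\gamma$ (sum over the neighbours $\delta$ of $\gamma$), and whose support (the set of vertices where $f$ is non-zero) has exactly $-2\theta_2=2(\sqrt{q}+1)$ elements.
   Context: For a vector $v=(v_1,v_2,v_3,v_4)\in\mathbb{F}_q^4$ and $u=(u_1,\dots,u_4)$, put $H(v,u)=v_1u_1^{\sqrt q}+v_2u_2^{\sqrt q}+v_3u_3^{\sqrt q}+v_4u_4^{\sqrt q}$. The graph $U(4,q)$ has as vertices the projective points $[v]$ of $PG(3,q)$ with $v\neq 0$ and $H(v,v)=0$ (isotropic points); distinct vertices $[v],[u]$ are adjacent iff $H(v,u)=0$. It is a primitive strongly regular graph with parameters $(v,k,\lambda,\mu)$ and eigenvalues $k>\theta_1>0>\theta_2$, where $\theta_2=-(\sqrt q+1)$. Weight-distribution bound: for a non-principal eigenvalue $\theta$ of a primitive strongly regular graph with parameters $(v,k,\lambda,\mu)$, any $\theta$-eigenfunction has at least $1+|\theta|+|((\theta-\lambda)\theta-k)/\mu|$ non-zeroes; for $\theta=\theta_2$ this number equals $-2\theta_2$. The bound is tight if some $\theta$-eigenfunction has exactly that many non-zeroes. -}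

module Defs where

open import Data.Nat as ℕ using (ℕ; zero; suc)
open import Data.Fin as Fin using (Fin)
open import Data.Fin.Properties as FinP using ()
open import Data.Bool using (Bool; true; false; T; if_then_else_; _∧_; not)
open import Data.Bool.Properties using (T?)
open import Data.List as List using (List; []; _∷_; [_]; map; concatMap; allFin; filter; length; mapMaybe)
open import Data.Maybe using (Maybe; just; nothing)
open import Data.Vec as Vec using (Vec; []; _∷_)
open import Data.Product using (Σ; ∃; _×_; _,_; proj₁)
open import Data.Integer as ℤ using (ℤ; +_)
open import Data.Rational as ℚ using (ℚ; 0ℚ)
open import Data.Rational.Properties as ℚP using ()
open import Relation.Nullary using (¬_; Dec; yes; no; ¬?)
open import Relation.Nullary.Decidable using (⌊_⌋)
open import Relation.Binary.PropositionalEquality using (_≡_; _≢_)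
open import Data.Vec.Properties as VecP using ()
open import Algebra.Structures using (IsCommutativeRing)

record FiniteField (q : ℕ) : Set where
  field
    _+_ _*_ : Fin q → Fin q → Fin q
    -_      : Fin q → Fin q
    0# 1#   : Fin q
    isCommutativeRing : IsCommutativeRing _≡_ _+_ _*_ -_ 0# 1#
    0≢1     : 0# ≢ 1#
    inverse : ∀ x → x ≢ 0# → ∃ λ y → x * y ≡ 1#

module UnitaryPolarGraph {q : ℕ} (F : FiniteField q) (r : ℕ) where
  -- r plays the role of √q
  open FiniteField F

  _==_ : Fin q → Fin q → Bool
  x == y = ⌊ x Fin.≟ y ⌋

  pow : Fin q → ℕ → Fin q
  pow x zero    = 1#
  pow x (suc n) = x * pow x n

  Vector : Set
  Vector = Vec (Fin q) 4

  allVecs : (n : ℕ) → List (Vec (Fin q) n)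
  allVecs zero    = [ [] ]
  allVecs (suc n) = concatMap (λ x → map (x ∷_) (allVecs n)) (allFin q)

  H : ∀ {n} → Vec (Fin q) n → Vec (Fin q) n → Fin q
  H []       []       = 0#
  H (x ∷ xs) (y ∷ ys) = (x * pow y r) + H xs ys

  -- canonical representative of a projective point: nonzero vector whose
  -- first nonzero coordinate equals 1 (the zero vector is rejected)
  normalisedᵇ : ∀ {n} → Vec (Fin q) n → Bool
  normalisedᵇ []       = false
  normalisedᵇ (x ∷ xs) = if x == 0# then normalisedᵇ xs else (x == 1#)

  isVertexᵇ : Vector → Bool
  isVertexᵇ v = normalisedᵇ v ∧ (H v v == 0#)

  Vertex : Set
  Vertex = Σ Vector (λ v → T (isVertexᵇ v))

  toVertex : Vector → Maybe Vertex
  toVertex v with T? (isVertexᵇ v)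
  ... | yes p = just (v , p)
  ... | no _  = nothing

  vertices : List Vertex
  vertices = mapMaybe toVertex (allVecs 4)

  adjacentᵇ : Vertex → Vertex → Bool
  adjacentᵇ (v , _) (u , _) = not ⌊ VecP.≡-dec Fin._≟_ v u ⌋ ∧ (H v u == 0#)

  neighbours : Vertex → List Vertex
  neighbours γ = filter (λ δ → T? (adjacentᵇ γ δ)) vertices

sumℚ : List ℚ → ℚ
sumℚ = List.foldr ℚ._+_ 0ℚ

module Submission where

-- Write r = √q and N x = x ^ (r + 1). The eigenfunction is +1 on the r + 1 isotropic points of the
-- hyperbolic line ⟨e₁, e₂⟩, −1 on the r + 1 isotropic points of the orthogonal line ⟨e₃, e₄⟩, and 0
-- elsewhere. A point of one line is orthogonal to every point of the other line and to no other point
-- of its own line, which gives −(r + 1) f = Σ f there. Any other isotropic point z is orthogonal to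
-- exactly one isotropic point of ⟨e₁, e₂⟩ or to none, according as N z₀ + N z₁ vanishes, and likewise
-- for ⟨e₃, e₄⟩ with N z₂ + N z₃; as the two sums add up to H(z, z) = 0, the neighbours of z contribute
-- +1 and −1 equally often. That each line has exactly r + 1 isotropic points, i.e. that x ^ (r + 1) = −1
-- has r + 1 solutions when q = r², follows from root counts for X ^ (r + 1) + 1 and for
-- (X ^ (r − 1) − 1)/(X + 1) composed with X ^ (r + 1), together with Fermat's little theorem.

open import Defs
open import Level using (0ℓ)
open import Function using (_∘_; id)
open import Function.Bundles using (Equivalence)
open import Data.Empty using (⊥-elim)
open import Data.Nat as ℕ using (ℕ; zero; suc; _∸_; _≤_; z≤n; s≤s)
import Data.Nat.Properties as ℕP
open import Data.Nat.ListAction using (sum)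
open import Data.Nat.Tactic.RingSolver using (solve-∀)
import Data.Integer as ℤ
import Data.Integer.Properties as ℤP
open import Data.Rational as ℚ using (ℚ; 0ℚ; 1ℚ; _/_)
open import Data.Rational.Properties using (_≟_)
import Data.Rational.Properties as ℚP
import Data.Rational.Unnormalised as ℚᵘ
import Data.Rational.Unnormalised.Properties as ℚᵘP
open import Data.Rational.Solver using (module +-*-Solver)
open import Data.Fin as Fin using (Fin)
open import Data.Fin.Properties using (punchInᵢ≢i)
open import Data.Fin.Permutation using (permutation)
open import Data.Bool using (Bool; true; false; if_then_else_; not; _∧_; _xor_; T)
open import Data.Bool.Properties using (∧-assoc; ∧-zeroʳ; ∧-identityʳ; ∧-conicalˡ; ∧-conicalʳ; T-≡)
open import Data.Maybe using (Maybe; just; nothing; maybe)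
open import Data.Product using (∃; _×_; _,_; proj₁; proj₂)
open import Data.Sum using (_⊎_; inj₁; inj₂; [_,_]′)
open import Data.Vec using (Vec; []; _∷_)
open import Data.Vec.Functional using (removeAt)
open import Data.Vec.Properties using (∷-injective)
import Data.Vec.Properties as VecP
open import Data.List using (List; []; _∷_; length; map; filter; concatMap; mapMaybe; _++_; replicate; allFin)
open import Data.List.Properties using (map-cong; length-++; length-replicate; ++-identityʳ; length-tabulate)
open import Data.List.Membership.Propositional using (_∈_)
open import Data.List.Membership.Propositional.Properties using (∈-allFin)
open import Data.List.Relation.Unary.All using (All; []; _∷_)
import Data.List.Relation.Unary.All as All
open import Data.List.Relation.Unary.All.Properties using (All¬⇒¬Any; all-filter)
open import Data.List.Relation.Unary.AllPairs using ([]; _∷_)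
open import Data.List.Relation.Unary.Any using (here; there)
open import Data.List.Relation.Unary.Unique.Propositional using (Unique)
open import Data.List.Relation.Unary.Unique.Propositional.Properties using (allFin⁺; filter⁺)
open import Algebra.Bundles using (CommutativeRing; CommutativeSemiring)
import Algebra.Properties.Ring as RingProperties
import Algebra.Properties.CommutativeSemigroup as CommutativeSemigroupProperties
import Algebra.Definitions.RawSemiring as RawSemiringDefinitions
import Algebra.Properties.Semiring.Exp as SemiringExp
import Algebra.Properties.CommutativeSemiring.Exp as CommutativeSemiringExp
import Algebra.Properties.CommutativeMonoid.Sum as CommutativeMonoidSum
open import Relation.Nullary using (¬_; yes; no; does; ¬?; contradiction)
open import Relation.Nullary.Decidable using (⌊_⌋; T?)
open import Relation.Unary using (Decidable)
open import Relation.Binary.Definitions using (DecidableEquality)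
open import Relation.Binary.PropositionalEquality
open +-*-Solver using (solve; _:+_; _:*_; _:-_; :-_; _:=_; con)

module BooleanEquality {A : Set} (_≟_ : DecidableEquality A) where

  infix 4 _==_
  _==_ : A → A → Bool
  x == y = ⌊ x ≟ y ⌋

  ≡⇒==-true : ∀ {x y} → x ≡ y → (x == y) ≡ true
  ≡⇒==-true {x} {y} x≡y with x ≟ y
  ... | yes _   = refl
  ... | no x≢y = contradiction x≡y x≢y

  ≢⇒==-false : ∀ {x y} → x ≢ y → (x == y) ≡ false
  ≢⇒==-false {x} {y} x≢y with x ≟ y
  ... | yes x≡y = contradiction x≡y x≢y
  ... | no _    = refl

  ==-true⇒≡ : ∀ {x y} → (x == y) ≡ true → x ≡ y
  ==-true⇒≡ {x} {y} eq with x ≟ y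
  ... | yes x≡y = x≡y

  not-==-true⇒≢ : ∀ {x y} → not (x == y) ≡ true → x ≢ y
  not-==-true⇒≢ {x} {y} ¬x==y x≡y with x ≟ y
  not-==-true⇒≢ () x≡y | yes _
  ... | no x≢y = x≢y x≡y

  ==-cong-⇔ : ∀ {x x′ y y′} → (x ≡ x′ → y ≡ y′) → (y ≡ y′ → x ≡ x′) → (x == x′) ≡ (y == y′)
  ==-cong-⇔ {x} {x′} {y} {y′} to from with x ≟ x′ | y ≟ y′
  ... | yes _   | yes _   = refl
  ... | yes p   | no ¬q  = contradiction (to p) ¬q
  ... | no ¬p  | yes q   = contradiction (from q) ¬p
  ... | no _    | no _    = refl

private variable
  A B : Set

count : (A → Bool) → List A → ℕ
count p []       = 0
count p (x ∷ xs) = if p x then suc (count p xs) else count p xs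

count-true : ∀ (xs : List A) → count (λ _ → true) xs ≡ length xs
count-true []       = refl
count-true (x ∷ xs) = cong suc (count-true xs)

module _ {p p′ : A → Bool} where

  count-cong : ∀ xs → (∀ x → p x ≡ p′ x) → count p xs ≡ count p′ xs
  count-cong []       p≗p′ = refl
  count-cong (x ∷ xs) p≗p′ rewrite p≗p′ x with p′ x
  ... | true  = cong suc (count-cong xs p≗p′)
  ... | false = count-cong xs p≗p′

  count-mono : ∀ xs → (∀ x → p x ≡ true → p′ x ≡ true) → count p xs ≤ count p′ xs
  count-mono []       p⇒p′ = z≤n
  count-mono (x ∷ xs) p⇒p′ with p x in px | p′ x in p′x
  ... | true  | true  = s≤s (count-mono xs p⇒p′)
  ... | true  | false = contradiction (trans (sym (p⇒p′ x px)) p′x) λ ()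
  ... | false | true  = ℕP.m≤n⇒m≤1+n (count-mono xs p⇒p′)
  ... | false | false = count-mono xs p⇒p′

  count-xor : ∀ xs → (∀ x → (p x ∧ p′ x) ≡ false) →
              count (λ x → p x xor p′ x) xs ≡ count p xs ℕ.+ count p′ xs
  count-xor []       disjoint = refl
  count-xor (x ∷ xs) disjoint with p x | p′ x | disjoint x
  ... | true  | false | _ = cong suc (count-xor xs disjoint)
  ... | false | true  | _ = trans (cong suc (count-xor xs disjoint)) (sym (ℕP.+-suc _ _))
  ... | false | false | _ = count-xor xs disjoint

module _ {p : A → Bool} where

  count-≡0 : ∀ xs → (∀ x → p x ≡ false) → count p xs ≡ 0
  count-≡0 []       ¬p = refl
  count-≡0 (x ∷ xs) ¬p rewrite ¬p x = count-≡0 xs ¬p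

  count-≡1 : ∀ {xs c} → Unique xs → c ∈ xs → p c ≡ true → (∀ x → p x ≡ true → x ≡ c) → count p xs ≡ 1
  count-≡1 (c∉xs ∷ _) (here refl) pc p⇒≡c rewrite pc =
    cong suc (count-≡0-All c∉xs)
    where
    count-≡0-All : ∀ {ys} → All (_ ≢_) ys → count p ys ≡ 0
    count-≡0-All []                = refl
    count-≡0-All {y ∷ _} (c≢y ∷ c∉ys) with p y in py
    ... | true  = contradiction (sym (p⇒≡c y py)) c≢y
    ... | false = count-≡0-All c∉ys
  count-≡1 {x ∷ _} (x∉xs ∷ !xs) (there c∈xs) pc p⇒≡c with p x in px
  ... | true  = contradiction (p⇒≡c x px) (λ { refl → All¬⇒¬Any x∉xs c∈xs })
  ... | false = count-≡1 !xs c∈xs pc p⇒≡c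

  count-split : ∀ (b : A → Bool) xs →
                count p xs ≡ count (λ x → p x ∧ b x) xs ℕ.+ count (λ x → p x ∧ not (b x)) xs
  count-split b []       = refl
  count-split b (x ∷ xs) with p x | b x
  ... | true  | true  = cong suc (count-split b xs)
  ... | true  | false = trans (cong suc (count-split b xs)) (sym (ℕP.+-suc _ _))
  ... | false | _     = count-split b xs

  count-suc⇒∃ : ∀ xs {k} → count p xs ≡ suc k → ∃ λ x → p x ≡ true
  count-suc⇒∃ (x ∷ xs) eq with p x in px
  ... | true  = x , px
  ... | false = count-suc⇒∃ xs eq

  count-++ : ∀ xs ys → count p (xs ++ ys) ≡ count p xs ℕ.+ count p ys
  count-++ []       ys = refl
  count-++ (x ∷ xs) ys with p x
  ... | true  = cong suc (count-++ xs ys)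
  ... | false = count-++ xs ys

  count-map : ∀ (f : B → A) xs → count p (map f xs) ≡ count (p ∘ f) xs
  count-map f []       = refl
  count-map f (x ∷ xs) with p (f x)
  ... | true  = cong suc (count-map f xs)
  ... | false = count-map f xs

  count-concatMap : ∀ (f : B → List A) xs → count p (concatMap f xs) ≡ sum (map (count p ∘ f) xs)
  count-concatMap f []       = refl
  count-concatMap f (x ∷ xs) = trans (count-++ (f x) (concatMap f xs)) (cong (count p (f x) ℕ.+_) (count-concatMap f xs))

  count-mapMaybe : ∀ (f : B → Maybe A) xs → count p (mapMaybe f xs) ≡ count (maybe p false ∘ f) xs
  count-mapMaybe f []       = refl
  count-mapMaybe f (x ∷ xs) with f x
  ... | nothing = count-mapMaybe f xs
  ... | just y with p y
  ...   | true  = cong suc (count-mapMaybe f xs)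
  ...   | false = count-mapMaybe f xs

  count-filter : ∀ {P : A → Set} (P? : Decidable P) xs → count p (filter P? xs) ≡ count (λ x → does (P? x) ∧ p x) xs
  count-filter P? []       = refl
  count-filter P? (x ∷ xs) with does (P? x)
  ... | true with p x
  ...   | true  = cong suc (count-filter P? xs)
  ...   | false = count-filter P? xs
  count-filter P? (x ∷ xs) | false = count-filter P? xs

  sum-indicator : ∀ xs → sum (map (λ x → if p x then 1 else 0) xs) ≡ count p xs
  sum-indicator []       = refl
  sum-indicator (x ∷ xs) with p x
  ... | true  = cong suc (sum-indicator xs)
  ... | false = sum-indicator xs

length-filter : ∀ {P : A → Set} (P? : Decidable P) xs → length (filter P? xs) ≡ count (does ∘ P?) xs
length-filter P? []       = refl
length-filter P? (x ∷ xs) with does (P? x)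
... | true  = cong suc (length-filter P? xs)
... | false = length-filter P? xs

sum-map-single : ∀ (g : A → ℕ) {xs c} → Unique xs → c ∈ xs → (∀ x → x ≢ c → g x ≡ 0) → sum (map g xs) ≡ g c
sum-map-single g (c∉xs ∷ _) (here refl) g≡0 = trans (cong (g _ ℕ.+_) (sum-≡0 c∉xs)) (ℕP.+-identityʳ _)
  where
  sum-≡0 : ∀ {ys} → All (_ ≢_) ys → sum (map g ys) ≡ 0
  sum-≡0 []            = refl
  sum-≡0 (c≢y ∷ c∉ys) = cong₂ ℕ._+_ (g≡0 _ (c≢y ∘ sym)) (sum-≡0 c∉ys)
sum-map-single g (x∉xs ∷ !xs) (there c∈xs) g≡0 =
  cong₂ ℕ._+_ (g≡0 _ λ { refl → All¬⇒¬Any x∉xs c∈xs }) (sum-map-single g !xs c∈xs g≡0)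

⟦_⟧ : ℕ → ℚ
⟦ n ⟧ = ℤ.+ n / 1

-- Reduction of ⟦ n ⟧ gets stuck on gcd n 1, so the computation is done in ℚᵘ.
⟦suc⟧ : ∀ n → ⟦ suc n ⟧ ≡ 1ℚ ℚ.+ ⟦ n ⟧
⟦suc⟧ n = ℚP.toℚᵘ-injective (begin-equality
  ℚ.toℚᵘ ⟦ suc n ⟧
    ≃⟨ ℚP.toℚᵘ-fromℚᵘ (ℚᵘ.mkℚᵘ (ℤ.+ suc n) 0) ⟩
  ℚᵘ.mkℚᵘ (ℤ.+ suc n) 0
    ≃⟨ ℚᵘ.*≡* (trans (ℤP.*-identityʳ (ℤ.+ suc n))
                     (sym (trans (ℤP.*-identityʳ _) (cong (λ t → ℤ.+ 1 ℤ.+ t) (ℤP.*-identityʳ (ℤ.+ n)))))) ⟩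
  ℚᵘ.1ℚᵘ ℚᵘ.+ ℚᵘ.mkℚᵘ (ℤ.+ n) 0
    ≃⟨ ℚᵘP.+-congʳ ℚᵘ.1ℚᵘ (ℚP.toℚᵘ-fromℚᵘ (ℚᵘ.mkℚᵘ (ℤ.+ n) 0)) ⟨
  ℚ.toℚᵘ 1ℚ ℚᵘ.+ ℚ.toℚᵘ ⟦ n ⟧
    ≃⟨ ℚP.toℚᵘ-homo-+ 1ℚ ⟦ n ⟧ ⟨
  ℚ.toℚᵘ (1ℚ ℚ.+ ⟦ n ⟧)  ∎)
  where open ℚᵘP.≤-Reasoning

χ : Bool → ℚ
χ true  = 1ℚ
χ false = 0ℚ

private
  ⟦if⟧ : Bool → ℕ → ℚ
  ⟦if⟧ u n = ⟦ (if u then suc n else n) ⟧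

  χ-step : ∀ u v m n → χ u ℚ.- χ v ℚ.+ (⟦ m ⟧ ℚ.- ⟦ n ⟧) ≡ ⟦if⟧ u m ℚ.- ⟦if⟧ v n
  χ-step true  true  m n =
    trans (solve 2 (λ X Y → (con 1ℚ :- con 1ℚ) :+ (X :- Y) := (con 1ℚ :+ X) :- (con 1ℚ :+ Y)) refl ⟦ m ⟧ ⟦ n ⟧)
          (sym (cong₂ ℚ._-_ (⟦suc⟧ m) (⟦suc⟧ n)))
  χ-step true  false m n =
    trans (solve 2 (λ X Y → (con 1ℚ :- con 0ℚ) :+ (X :- Y) := (con 1ℚ :+ X) :- Y) refl ⟦ m ⟧ ⟦ n ⟧)
          (sym (cong (ℚ._- ⟦ n ⟧) (⟦suc⟧ m)))
  χ-step false true  m n =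
    trans (solve 2 (λ X Y → (con 0ℚ :- con 1ℚ) :+ (X :- Y) := X :- (con 1ℚ :+ Y)) refl ⟦ m ⟧ ⟦ n ⟧)
          (sym (cong (λ t → ⟦ m ⟧ ℚ.- t) (⟦suc⟧ n)))
  χ-step false false m n =
    solve 2 (λ X Y → (con 0ℚ :- con 0ℚ) :+ (X :- Y) := X :- Y) refl ⟦ m ⟧ ⟦ n ⟧

sumℚ-χ-χ : ∀ (a b : A → Bool) xs →
           sumℚ (map (λ x → χ (a x) ℚ.- χ (b x)) xs) ≡ ⟦ count a xs ⟧ ℚ.- ⟦ count b xs ⟧
sumℚ-χ-χ a b []       = refl
sumℚ-χ-χ a b (x ∷ xs) = trans (cong (χ (a x) ℚ.- χ (b x) ℚ.+_) (sumℚ-χ-χ a b xs)) (χ-step (a x) (b x) _ _)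

χ-χ≢0 : ∀ a b → does (¬? (χ a ℚ.- χ b ≟ 0ℚ)) ≡ a xor b
χ-χ≢0 true  true  = refl
χ-χ≢0 true  false = refl
χ-χ≢0 false true  = refl
χ-χ≢0 false false = refl

module FieldProperties {q : ℕ} (F : FiniteField q) where
  open FiniteField F public using (0#; 1#; 0≢1; inverse)

  commutativeRing : CommutativeRing 0ℓ 0ℓ
  commutativeRing = record { isCommutativeRing = FiniteField.isCommutativeRing F }

  open CommutativeRing commutativeRing public
    using (_+_; _*_; -_; _-_; +-assoc; +-comm; +-identityˡ; +-identityʳ; -‿inverseˡ; -‿inverseʳ;
           *-assoc; *-comm; *-identityˡ; *-identityʳ; distribˡ; distribʳ; zeroˡ; zeroʳ)
  open CommutativeRing commutativeRing public using (+-commutativeSemigroup; *-commutativeSemigroup)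
  open CommutativeRing commutativeRing using (ring; semiring; commutativeSemiring; *-commutativeMonoid)

  open RingProperties ring public
    using (-‿distribˡ-*; -‿distribʳ-*; -‿involutive; -0#≈0#; +-inverseʳ-unique; x∙y⁻¹≈ε⇒x≈y; x≈y⇒x∙y⁻¹≈ε)
  open RawSemiringDefinitions (CommutativeSemiring.rawSemiring commutativeSemiring) public
    using () renaming (_^_ to infixr 8 _^_)
  open SemiringExp semiring public using (^-homo-*; ^-assocʳ)
  open CommutativeSemiringExp commutativeSemiring public using (^-distrib-*)
  open ≡-Reasoning

  open BooleanEquality (Fin._≟_ {q}) public
  module +-CS = CommutativeSemigroupProperties +-commutativeSemigroup
  module *-CS = CommutativeSemigroupProperties *-commutativeSemigroup

  2≤q : 2 ℕ.≤ q
  2≤q = two-elements 0# 1# 0≢1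
    where
    two-elements : ∀ {n} (x y : Fin n) → x ≢ y → 2 ℕ.≤ n
    two-elements {1}           Fin.zero Fin.zero x≢y = contradiction refl x≢y
    two-elements {suc (suc n)} _        _        _   = ℕ.s≤s (ℕ.s≤s ℕ.z≤n)

  1≢0 : 1# ≢ 0#
  1≢0 = 0≢1 ∘ sym

  -1≢0 : - 1# ≢ 0#
  -1≢0 -1≡0 = 1≢0 (begin
    1#         ≡⟨ -‿involutive 1# ⟨
    - (- 1#)   ≡⟨ cong -_ -1≡0 ⟩
    - 0#       ≡⟨ -0#≈0# ⟩
    0#         ∎)

  x-y+y≡x : ∀ x y → x - y + y ≡ x
  x-y+y≡x x y = begin
    x - y + y      ≡⟨ +-assoc x (- y) y ⟩
    x + (- y + y)  ≡⟨ cong (x +_) (-‿inverseˡ y) ⟩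
    x + 0#         ≡⟨ +-identityʳ x ⟩
    x              ∎

  x+y≡0⇒[x==0]≡[y==0] : ∀ {x y} → x + y ≡ 0# → (x == 0#) ≡ (y == 0#)
  x+y≡0⇒[x==0]≡[y==0] {x} {y} x+y≡0 = ==-cong-⇔
    (λ x≡0 → trans (+-inverseʳ-unique x y x+y≡0) (trans (cong -_ x≡0) -0#≈0#))
    (λ y≡0 → trans (sym (+-identityʳ x)) (trans (cong (x +_) (sym y≡0)) x+y≡0))

  x*-1≡-x : ∀ x → x * - 1# ≡ - x
  x*-1≡-x x = trans (sym (-‿distribʳ-* x 1#)) (cong -_ (*-identityʳ x))

  *-cancelˡ : ∀ x {y z} → x ≢ 0# → x * y ≡ x * z → y ≡ z
  *-cancelˡ x {y} {z} x≢0 xy≡xz with inverse x x≢0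
  ... | x⁻¹ , xx⁻¹≡1 = begin
    y                ≡⟨ *-identityˡ y ⟨
    1# * y           ≡⟨ cong (_* y) x⁻¹x≡1 ⟨
    x⁻¹ * x * y      ≡⟨ *-assoc x⁻¹ x y ⟩
    x⁻¹ * (x * y)    ≡⟨ cong (x⁻¹ *_) xy≡xz ⟩
    x⁻¹ * (x * z)    ≡⟨ *-assoc x⁻¹ x z ⟨
    x⁻¹ * x * z      ≡⟨ cong (_* z) x⁻¹x≡1 ⟩
    1# * z           ≡⟨ *-identityˡ z ⟩
    z                ∎
    where x⁻¹x≡1 = trans (*-comm x⁻¹ x) xx⁻¹≡1

  x*y≡0⇒x≡0⊎y≡0 : ∀ x y → x * y ≡ 0# → x ≡ 0# ⊎ y ≡ 0#
  x*y≡0⇒x≡0⊎y≡0 x y xy≡0 with x Fin.≟ 0#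
  ... | yes x≡0 = inj₁ x≡0
  ... | no x≢0  = inj₂ (*-cancelˡ x x≢0 (trans xy≡0 (sym (zeroʳ x))))

  x^n≡0⇒x≡0 : ∀ x n → x ^ n ≡ 0# → x ≡ 0#
  x^n≡0⇒x≡0 x zero    1≡0  = contradiction 1≡0 1≢0
  x^n≡0⇒x≡0 x (suc n) xxⁿ≡0 with x*y≡0⇒x≡0⊎y≡0 x (x ^ n) xxⁿ≡0
  ... | inj₁ x≡0  = x≡0
  ... | inj₂ xⁿ≡0 = x^n≡0⇒x≡0 x n xⁿ≡0

  1^n≡1 : ∀ n → 1# ^ n ≡ 1#
  1^n≡1 zero    = refl
  1^n≡1 (suc n) = trans (*-identityˡ _) (1^n≡1 n)

  0^n≡0 : ∀ n → n ≢ 0 → 0# ^ n ≡ 0#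
  0^n≡0 zero    n≢0 = contradiction refl n≢0
  0^n≡0 (suc n) _   = zeroˡ _

  -1^[n+n]≡1 : ∀ n → (- 1#) ^ (n ℕ.+ n) ≡ 1#
  -1^[n+n]≡1 n = begin
    (- 1#) ^ (n ℕ.+ n)          ≡⟨ ^-homo-* (- 1#) n n ⟩
    (- 1#) ^ n * (- 1#) ^ n     ≡⟨ ^-distrib-* (- 1#) (- 1#) n ⟨
    (- 1# * - 1#) ^ n           ≡⟨ cong (_^ n) (trans (x*-1≡-x (- 1#)) (-‿involutive 1#)) ⟩
    1# ^ n                      ≡⟨ 1^n≡1 n ⟩
    1#                          ∎

  private
    open CommutativeMonoidSum *-commutativeMonoid
      using (sum-remove; sum-replicate; sum-cong-≗; sum-permute; ∑-distrib-+)
      renaming (sum to product)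

    product-nonzero : ∀ {n} (t : Fin n → Fin q) → (∀ i → t i ≢ 0#) → product t ≢ 0#
    product-nonzero {zero}  t t≢0 = 1≢0
    product-nonzero {suc n} t t≢0 t₀∏≡0 with x*y≡0⇒x≡0⊎y≡0 (t Fin.zero) _ t₀∏≡0
    ... | inj₁ t₀≡0 = t≢0 Fin.zero t₀≡0
    ... | inj₂ ∏≡0  = product-nonzero (t ∘ Fin.suc) (t≢0 ∘ Fin.suc) ∏≡0

    product-except : ∀ {n} (k : Fin n) x → product (λ i → if ⌊ i Fin.≟ k ⌋ then 1# else x) ≡ x ^ (n ∸ 1)
    product-except {suc n} k x = begin
      product t                     ≡⟨ sum-remove {i = k} t ⟩
      t k * product (removeAt t k)  ≡⟨ cong₂ _*_ tk≡1 (sum-cong-≗ {n} t[punchIn]≡x) ⟩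
      1# * product {n} (λ _ → x)    ≡⟨ *-identityˡ _ ⟩
      product {n} (λ _ → x)         ≡⟨ sum-replicate n ⟩
      x ^ n                         ∎
      where
      t = λ i → if ⌊ i Fin.≟ k ⌋ then 1# else x
      tk≡1 : t k ≡ 1#
      tk≡1 with k Fin.≟ k
      ... | yes _   = refl
      ... | no k≢k = contradiction refl k≢k
      t[punchIn]≡x : ∀ j → t (Fin.punchIn k j) ≡ x
      t[punchIn]≡x j with Fin.punchIn k j Fin.≟ k
      ... | yes eq = contradiction eq (punchInᵢ≢i k j)
      ... | no _   = refl

  fermat : ∀ x → x ≢ 0# → x ^ (q ∸ 1) ≡ 1#
  fermat x x≢0 with inverse x x≢0
  ... | x⁻¹ , xx⁻¹≡1 = *-cancelˡ P P≢0 (begin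
    P * x ^ (q ∸ 1)              ≡⟨ *-comm P _ ⟩
    x ^ (q ∸ 1) * P              ≡⟨ cong (_* P) (product-except 0# x) ⟨
    product h * P                ≡⟨ ∑-distrib-+ h g ⟨
    product (λ y → h y * g y)    ≡⟨ sum-cong-≗ g[xy]≡h[y]g[y] ⟨
    product (λ y → g (x * y))    ≡⟨ sum-permute g x* ⟨
    P                            ≡⟨ *-identityʳ P ⟨
    P * 1#                       ∎)
    where
    -- g replaces 0 by 1, so that P is the product of all nonzero elements.
    g h : Fin q → Fin q
    g y = if y == 0# then 1# else y
    h y = if y == 0# then 1# else x
    P = product g
    g≢0 : ∀ y → g y ≢ 0#
    g≢0 y with y Fin.≟ 0#
    ... | yes _   = 1≢0
    ... | no y≢0 = y≢0
    x⁻¹x≡1 = trans (*-comm x⁻¹ x) xx⁻¹≡1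
    x* = permutation (x *_) (x⁻¹ *_)
      (λ y → trans (sym (*-assoc x x⁻¹ y)) (trans (cong (_* y) xx⁻¹≡1) (*-identityˡ y)))
      (λ y → trans (sym (*-assoc x⁻¹ x y)) (trans (cong (_* y) x⁻¹x≡1) (*-identityˡ y)))
    g[xy]≡h[y]g[y] : ∀ y → g (x * y) ≡ h y * g y
    g[xy]≡h[y]g[y] y with y Fin.≟ 0# | x * y Fin.≟ 0#
    ... | yes _   | yes _    = sym (*-identityˡ 1#)
    ... | yes y≡0 | no xy≢0  = contradiction (trans (cong (x *_) y≡0) (zeroʳ x)) xy≢0
    ... | no y≢0  | yes xy≡0 = ⊥-elim ([ x≢0 , y≢0 ]′ (x*y≡0⇒x≡0⊎y≡0 x y xy≡0))
    ... | no _    | no _     = refl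
    P≢0 : P ≢ 0#
    P≢0 = product-nonzero g g≢0

module MonicPolynomials {q : ℕ} (F : FiniteField q) where
  open FieldProperties F
  open ≡-Reasoning

  -- monic cs is the monic polynomial of degree length cs whose other coefficients are cs,
  -- constant term first; a monic polynomial is never the zero polynomial.
  monic : List (Fin q) → Fin q → Fin q
  monic []       x = 1#
  monic (c ∷ cs) x = c + x * monic cs x

  private
    *-split : ∀ x a y → x * y ≡ (x - a) * y + a * y
    *-split x a y = trans (cong (_* y) (sym (x-y+y≡x x a))) (distribʳ y (x - a) a)

  monic-division : ∀ c cs a → ∃ λ ds → length ds ≡ length cs ×
                   (∀ x → monic (c ∷ cs) x ≡ (x - a) * monic ds x + monic (c ∷ cs) a)
  monic-division c []        a = [] , refl , λ x → begin
    c + x * 1#                   ≡⟨ cong (c +_) (*-split x a 1#) ⟩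
    c + ((x - a) * 1# + a * 1#)  ≡⟨ +-CS.x∙yz≈y∙xz c _ _ ⟩
    (x - a) * 1# + (c + a * 1#)  ∎
  monic-division c (c′ ∷ cs) a with monic-division c′ cs a
  ... | ds , ∣ds∣≡∣cs∣ , divides = R ∷ ds , cong suc ∣ds∣≡∣cs∣ , λ x → begin
    c + x * monic (c′ ∷ cs) x
      ≡⟨ cong (λ e → c + x * e) (divides x) ⟩
    c + x * ((x - a) * monic ds x + R)
      ≡⟨ cong (c +_) (distribˡ x _ R) ⟩
    c + (x * ((x - a) * monic ds x) + x * R)
      ≡⟨ cong₂ (λ s t → c + (s + t)) (*-CS.x∙yz≈y∙xz x (x - a) _) (*-split x a R) ⟩
    c + ((x - a) * (x * monic ds x) + ((x - a) * R + a * R))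
      ≡⟨ +-CS.x∙yz≈y∙xz c _ _ ⟩
    (x - a) * (x * monic ds x) + (c + ((x - a) * R + a * R))
      ≡⟨ cong ((x - a) * (x * monic ds x) +_) (+-CS.x∙yz≈y∙xz c _ _) ⟩
    (x - a) * (x * monic ds x) + ((x - a) * R + (c + a * R))
      ≡⟨ +-CS.x∙yz≈yx∙z _ _ _ ⟩
    ((x - a) * R + (x - a) * (x * monic ds x)) + (c + a * R)
      ≡⟨ cong (_+ (c + a * R)) (distribˡ (x - a) R _) ⟨
    (x - a) * (R + x * monic ds x) + (c + a * R)  ∎
    where R = monic (c′ ∷ cs) a

  deflation : ∀ c cs a → monic (c ∷ cs) a ≡ 0# →
              ∃ λ ds → length ds ≡ length cs × (∀ x → x ≢ a → monic (c ∷ cs) x ≡ 0# → monic ds x ≡ 0#)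
  deflation c cs a pa≡0 with monic-division c cs a
  ... | ds , ∣ds∣≡∣cs∣ , divides = ds , ∣ds∣≡∣cs∣ , root-of-quotient
    where
    root-of-quotient : ∀ x → x ≢ a → monic (c ∷ cs) x ≡ 0# → monic ds x ≡ 0#
    root-of-quotient x x≢a px≡0 with x*y≡0⇒x≡0⊎y≡0 (x - a) (monic ds x) (begin
      (x - a) * monic ds x                      ≡⟨ +-identityʳ _ ⟨
      (x - a) * monic ds x + 0#                 ≡⟨ cong ((x - a) * monic ds x +_) pa≡0 ⟨
      (x - a) * monic ds x + monic (c ∷ cs) a   ≡⟨ divides x ⟨
      monic (c ∷ cs) x                          ≡⟨ px≡0 ⟩
      0#                                        ∎)
    ... | inj₁ x-a≡0 = contradiction (x∙y⁻¹≈ε⇒x≈y x a x-a≡0) x≢a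
    ... | inj₂ dx≡0  = dx≡0

  roots≤degree : ∀ cs {xs} → Unique xs → All (λ x → monic cs x ≡ 0#) xs → length xs ≤ length cs
  roots≤degree cs        {[]}     _            _            = z≤n
  roots≤degree []        {x ∷ _}  _            (1≡0 ∷ _)   = contradiction 1≡0 1≢0
  roots≤degree (c ∷ cs)  {a ∷ xs} (a∉xs ∷ !xs) (pa≡0 ∷ pxs≡0) with deflation c cs a pa≡0
  ... | ds , ∣ds∣≡∣cs∣ , deflate =
    s≤s (subst (length xs ≤_) ∣ds∣≡∣cs∣ (roots≤degree ds !xs
      (All.zipWith (λ (a≢x , px≡0) → deflate _ (a≢x ∘ sym) px≡0) (a∉xs , pxs≡0))))

  monic-zeros++ : ∀ k cs x → monic (replicate k 0# ++ cs) x ≡ x ^ k * monic cs x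
  monic-zeros++ zero    cs x = sym (*-identityˡ _)
  monic-zeros++ (suc k) cs x = begin
    0# + x * monic (replicate k 0# ++ cs) x  ≡⟨ +-identityˡ _ ⟩
    x * monic (replicate k 0# ++ cs) x       ≡⟨ cong (x *_) (monic-zeros++ k cs x) ⟩
    x * (x ^ k * monic cs x)                 ≡⟨ *-assoc x _ _ ⟨
    x ^ suc k * monic cs x                   ∎

  X^[1+_]-_ : ℕ → Fin q → List (Fin q)
  X^[1+ n ]- c = - c ∷ replicate n 0#

  monic-X^[1+n]-c : ∀ n c x → monic (X^[1+ n ]- c) x ≡ x ^ suc n - c
  monic-X^[1+n]-c n c x = begin
    - c + x * monic (replicate n 0#) x
      ≡⟨ cong (λ cs → - c + x * monic cs x) (++-identityʳ (replicate n 0#)) ⟨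
    - c + x * monic (replicate n 0# ++ []) x
      ≡⟨ cong (λ y → - c + x * y) (trans (monic-zeros++ n [] x) (*-identityʳ _)) ⟩
    - c + x ^ suc n
      ≡⟨ +-comm (- c) _ ⟩
    x ^ suc n - c  ∎

  _∘X^[1+_] : List (Fin q) → ℕ → List (Fin q)
  []       ∘X^[1+ e ] = []
  (c ∷ cs) ∘X^[1+ e ] = c ∷ (replicate e 0# ++ cs ∘X^[1+ e ])

  monic-∘X^[1+e] : ∀ cs e x → monic (cs ∘X^[1+ e ]) x ≡ monic cs (x ^ suc e)
  monic-∘X^[1+e] []       e x = refl
  monic-∘X^[1+e] (c ∷ cs) e x = cong (c +_) (begin
    x * monic (replicate e 0# ++ cs ∘X^[1+ e ]) x   ≡⟨ cong (x *_) (monic-zeros++ e _ x) ⟩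
    x * (x ^ e * monic (cs ∘X^[1+ e ]) x)           ≡⟨ *-assoc x _ _ ⟨
    x ^ suc e * monic (cs ∘X^[1+ e ]) x             ≡⟨ cong (x ^ suc e *_) (monic-∘X^[1+e] cs e x) ⟩
    x ^ suc e * monic cs (x ^ suc e)                ∎)

  length-∘X^[1+e] : ∀ cs e → length (cs ∘X^[1+ e ]) ≡ length cs ℕ.* suc e
  length-∘X^[1+e] []       e = refl
  length-∘X^[1+e] (c ∷ cs) e = cong suc (begin
    length (replicate e 0# ++ cs ∘X^[1+ e ])
      ≡⟨ length-++ (replicate e 0#) ⟩
    length (replicate e 0#) ℕ.+ length (cs ∘X^[1+ e ])
      ≡⟨ cong₂ ℕ._+_ (length-replicate e) (length-∘X^[1+e] cs e) ⟩
    e ℕ.+ length cs ℕ.* suc e  ∎)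

  count-roots≤degree : ∀ cs (p : Fin q → Bool) → (∀ x → p x ≡ true → monic cs x ≡ 0#) →
                       count p (allFin q) ≤ length cs
  count-roots≤degree cs p p⇒root = subst (_≤ length cs) (length-filter (T? ∘ p) (allFin q))
    (roots≤degree cs (filter⁺ (T? ∘ p) (allFin⁺ q))
      (All.map (p⇒root _ ∘ Equivalence.to T-≡) (all-filter (T? ∘ p) (allFin q))))

module PowerEquations {q : ℕ} (F : FiniteField q) where
  open FieldProperties F
  open MonicPolynomials F

  count-nonzero : count (λ x → not (x == 0#)) (allFin q) ≡ q ∸ 1
  count-nonzero = begin
    count nz (allFin q)
      ≡⟨ ℕP.m+n∸m≡n 1 _ ⟨
    (1 ℕ.+ count nz (allFin q)) ∸ 1
      ≡⟨ cong (λ k → k ℕ.+ count nz (allFin q) ∸ 1) count-zero ⟨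
    (count (_== 0#) (allFin q) ℕ.+ count nz (allFin q)) ∸ 1
      ≡⟨ cong (_∸ 1) (count-split (_== 0#) (allFin q)) ⟨
    count (λ _ → true) (allFin q) ∸ 1
      ≡⟨ cong (_∸ 1) (trans (count-true (allFin q)) (length-tabulate {n = q} id)) ⟩
    q ∸ 1  ∎
    where
    open ≡-Reasoning
    nz = λ x → not (x == 0#)
    count-zero : count (_== 0#) (allFin q) ≡ 1
    count-zero = count-≡1 (allFin⁺ q) (∈-allFin 0#) (≡⇒==-true refl) (λ _ → ==-true⇒≡)

  count-x^[1+n]≡c≤1+n : ∀ n c → count (λ x → x ^ suc n == c) (allFin q) ≤ suc n
  count-x^[1+n]≡c≤1+n n c = subst (count (λ x → x ^ suc n == c) (allFin q) ≤_) (cong suc (length-replicate n))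
    (count-roots≤degree (X^[1+ n ]- c) _ λ x xⁿ⁺¹==c →
      trans (monic-X^[1+n]-c n c x) (x≈y⇒x∙y⁻¹≈ε (==-true⇒≡ xⁿ⁺¹==c)))

  -- Every nonzero x satisfies (x ^ (n+1)) ^ (m+1) = 1, so x ^ (n+1) = -1 unless x ^ (n+1) is a root of
  -- (X^(m+1) - 1)/(X + 1); this gives at most m(n+1) nonzero x with x ^ (n+1) ≢ -1.
  count-x^[1+n]≡-1≥1+n : ∀ n m → q ∸ 1 ≡ suc n ℕ.* suc m → (- 1#) ^ suc m ≡ 1# →
                         suc n ≤ count (λ x → x ^ suc n == - 1#) (allFin q)
  count-x^[1+n]≡-1≥1+n n m q∸1≡ -1^[1+m]≡1
    with deflation (- 1#) (replicate m 0#) (- 1#) (trans (monic-X^[1+n]-c m 1# (- 1#)) (x≈y⇒x∙y⁻¹≈ε -1^[1+m]≡1))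
  ... | ds , ∣ds∣≡m , deflate = ℕP.+-cancelʳ-≤ (m ℕ.* suc n) (suc n) _ (begin
    suc n ℕ.+ m ℕ.* suc n
      ≡⟨ ℕP.*-comm (suc m) (suc n) ⟩
    suc n ℕ.* suc m
      ≡⟨ q∸1≡ ⟨
    q ∸ 1
      ≡⟨ count-nonzero ⟨
    count nz (allFin q)
      ≡⟨ count-split root (allFin q) ⟩
    count (λ x → nz x ∧ root x) (allFin q) ℕ.+ count (λ x → nz x ∧ not (root x)) (allFin q)
      ≤⟨ ℕP.+-mono-≤ (count-mono (allFin q) (λ x → ∧-conicalʳ (nz x) (root x))) nonroots ⟩
    count root (allFin q) ℕ.+ m ℕ.* suc n  ∎)
    where
    open ℕP.≤-Reasoning
    nz root : Fin q → Bool
    nz x   = not (x == 0#)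
    root x = x ^ suc n == - 1#
    nonroots : count (λ x → nz x ∧ not (root x)) (allFin q) ≤ m ℕ.* suc n
    nonroots = subst (count (λ x → nz x ∧ not (root x)) (allFin q) ≤_) ∣G∣≡m[1+n]
      (count-roots≤degree (ds ∘X^[1+ n ]) _ G-root)
      where
      ∣G∣≡m[1+n] = trans (length-∘X^[1+e] ds n) (cong (ℕ._* suc n) (trans ∣ds∣≡m (length-replicate m)))
      G-root : ∀ x → (nz x ∧ not (root x)) ≡ true → monic (ds ∘X^[1+ n ]) x ≡ 0#
      G-root x nz∧¬root = trans (monic-∘X^[1+e] ds n x)
        (deflate (x ^ suc n) (not-==-true⇒≢ (∧-conicalʳ (nz x) _ nz∧¬root))
          (trans (monic-X^[1+n]-c m 1# _) (x≈y⇒x∙y⁻¹≈ε xⁿ⁺¹ᵐ⁺¹≡1)))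
        where
        xⁿ⁺¹ᵐ⁺¹≡1 : (x ^ suc n) ^ suc m ≡ 1#
        xⁿ⁺¹ᵐ⁺¹≡1 = trans (^-assocʳ x (suc n) (suc m))
          (trans (cong (x ^_) (sym q∸1≡)) (fermat x (not-==-true⇒≢ (∧-conicalˡ (nz x) _ nz∧¬root))))

  private
    even-or-odd : ∀ n → ∃ λ j → n ≡ j ℕ.+ j ⊎ n ≡ suc (j ℕ.+ j)
    even-or-odd zero    = 0 , inj₁ refl
    even-or-odd (suc n) with even-or-odd n
    ... | j , inj₁ n≡2j   = j , inj₂ (cong suc n≡2j)
    ... | j , inj₂ n≡2j+1 = suc j , inj₁ (trans (cong suc n≡2j+1) (cong suc (sym (ℕP.+-suc j j))))

    -- If r - 1 is odd then q - 1 = r² - 1 is odd as well, which forces -1 = 1 by Fermat's little theorem.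
    -1^[r∸1]≡1 : ∀ k → q ≡ (2 ℕ.+ k) ℕ.* (2 ℕ.+ k) → (- 1#) ^ suc k ≡ 1#
    -1^[r∸1]≡1 k q≡r*r with even-or-odd k
    ... | j , inj₂ k≡2j+1 =
      trans (cong ((- 1#) ^_) (trans (cong suc k≡2j+1) (cong suc (sym (ℕP.+-suc j j))))) (-1^[n+n]≡1 (suc j))
    ... | j , inj₁ k≡2j   = trans (cong (λ x → x ^ suc k) -1≡1) (1^n≡1 (suc k))
      where
      i = 2 ℕ.* j ℕ.* j ℕ.+ 4 ℕ.* j ℕ.+ 1
      q∸1≡1+2i : q ∸ 1 ≡ suc (i ℕ.+ i)
      q∸1≡1+2i = cong (_∸ 1) (trans q≡r*r (trans (cong (λ k → (2 ℕ.+ k) ℕ.* (2 ℕ.+ k)) k≡2j) (odd-square j)))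
        where
        odd-square : ∀ j → (2 ℕ.+ (j ℕ.+ j)) ℕ.* (2 ℕ.+ (j ℕ.+ j)) ≡
                           1 ℕ.+ suc ((2 ℕ.* j ℕ.* j ℕ.+ 4 ℕ.* j ℕ.+ 1) ℕ.+ (2 ℕ.* j ℕ.* j ℕ.+ 4 ℕ.* j ℕ.+ 1))
        odd-square = solve-∀
      -1≡1 : - 1# ≡ 1#
      -1≡1 = begin
        - 1#                          ≡⟨ *-identityʳ (- 1#) ⟨
        - 1# * 1#                     ≡⟨ cong (- 1# *_) (-1^[n+n]≡1 i) ⟨
        (- 1#) ^ suc (i ℕ.+ i)        ≡⟨ cong ((- 1#) ^_) q∸1≡1+2i ⟨
        (- 1#) ^ (q ∸ 1)              ≡⟨ fermat (- 1#) -1≢0 ⟩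
        1#                            ∎
        where open ≡-Reasoning

  count-x^[1+r]≡-1 : ∀ r → q ≡ r ℕ.* r → count (λ x → x ^ suc r == - 1#) (allFin q) ≡ suc r
  count-x^[1+r]≡-1 0             q≡0 = contradiction (subst (2 ≤_) q≡0 2≤q) λ ()
  count-x^[1+r]≡-1 1             q≡1 = contradiction (subst (2 ≤_) q≡1 2≤q) λ { (s≤s ()) }
  count-x^[1+r]≡-1 (suc (suc k)) q≡r*r = ℕP.≤-antisym (count-x^[1+n]≡c≤1+n _ _)
    (count-x^[1+n]≡-1≥1+n _ k (cong (_∸ 1) (trans q≡r*r (r*r≡1+[r+1][r-1] k))) (-1^[r∸1]≡1 k q≡r*r))
    where
    r*r≡1+[r+1][r-1] : ∀ k → (2 ℕ.+ k) ℕ.* (2 ℕ.+ k) ≡ 1 ℕ.+ (3 ℕ.+ k) ℕ.* (1 ℕ.+ k)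
    r*r≡1+[r+1][r-1] = solve-∀

module HyperbolicLine {q : ℕ} (F : FiniteField q) (r : ℕ) where
  open FieldProperties F
  open ≡-Reasoning

  N : Fin q → Fin q
  N x = x ^ suc r

  private
    orthogonal⇒xb≡y : ∀ {x y b} → N b ≡ - 1# → x + y * b ^ r ≡ 0# → x * b ≡ y
    orthogonal⇒xb≡y {x} {y} {b} Nb≡-1 x+ybʳ≡0 = x∙y⁻¹≈ε⇒x≈y (x * b) y (begin
      x * b - y                 ≡⟨ cong (x * b +_) (x*-1≡-x y) ⟨
      x * b + y * - 1#          ≡⟨ cong (λ t → x * b + y * t) Nb≡-1 ⟨
      x * b + y * (b * b ^ r)   ≡⟨ cong₂ _+_ (*-comm x b) (*-CS.x∙yz≈y∙xz y b _) ⟩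
      b * x + b * (y * b ^ r)   ≡⟨ distribˡ b x _ ⟨
      b * (x + y * b ^ r)       ≡⟨ cong (b *_) x+ybʳ≡0 ⟩
      b * 0#                    ≡⟨ zeroʳ b ⟩
      0#                        ∎)

  N-sum≡0⇒x≡0⇒y≡0 : ∀ {x y} → N x + N y ≡ 0# → x ≡ 0# → y ≡ 0#
  N-sum≡0⇒x≡0⇒y≡0 {x} {y} Nx+Ny≡0 refl = x^n≡0⇒x≡0 y (suc r) (trans (sym (+-identityˡ (N y)))
    (trans (cong (_+ N y) (sym (0^n≡0 (suc r) λ ()))) Nx+Ny≡0))

  orthogonal⇒N-sum≡0 : ∀ {x y b} → N b ≡ - 1# → x + y * b ^ r ≡ 0# → N x + N y ≡ 0#
  orthogonal⇒N-sum≡0 {x} {y} {b} Nb≡-1 x+ybʳ≡0 = begin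
    N x + N y              ≡⟨ cong (λ t → N x + N t) (orthogonal⇒xb≡y Nb≡-1 x+ybʳ≡0) ⟨
    N x + N (x * b)        ≡⟨ cong (N x +_) (^-distrib-* x b (suc r)) ⟩
    N x + N x * N b        ≡⟨ cong (λ t → N x + N x * t) Nb≡-1 ⟩
    N x + N x * - 1#       ≡⟨ cong (N x +_) (x*-1≡-x (N x)) ⟩
    N x - N x              ≡⟨ -‿inverseʳ (N x) ⟩
    0#                     ∎

  orthogonal-unique : ∀ {x y b b′} → (x , y) ≢ (0# , 0#) → N b ≡ - 1# → N b′ ≡ - 1# →
                      x + y * b ^ r ≡ 0# → x + y * b′ ^ r ≡ 0# → b ≡ b′
  orthogonal-unique {x} {y} {b} {b′} xy≢0 Nb≡-1 Nb′≡-1 ⊥b ⊥b′ with x Fin.≟ 0#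
  ... | yes x≡0 = contradiction (cong₂ _,_ x≡0 (N-sum≡0⇒x≡0⇒y≡0 (orthogonal⇒N-sum≡0 Nb≡-1 ⊥b) x≡0)) xy≢0
  ... | no x≢0  = *-cancelˡ x x≢0 (trans (orthogonal⇒xb≡y Nb≡-1 ⊥b) (sym (orthogonal⇒xb≡y Nb′≡-1 ⊥b′)))

  orthogonal-exists : ∀ {x y} → (x , y) ≢ (0# , 0#) → N x + N y ≡ 0# → ∃ λ b → N b ≡ - 1# × x + y * b ^ r ≡ 0#
  orthogonal-exists {x} {y} xy≢0 Nx+Ny≡0 with x Fin.≟ 0#
  ... | yes x≡0 = contradiction (cong₂ _,_ x≡0 (N-sum≡0⇒x≡0⇒y≡0 Nx+Ny≡0 x≡0)) xy≢0
  ... | no x≢0 with inverse x x≢0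
  ...   | x⁻¹ , xx⁻¹≡1 = b , Nb≡-1 , (begin
    x + y * b ^ r          ≡⟨ cong (λ t → x + t * b ^ r) xb≡y ⟨
    x + x * b * b ^ r      ≡⟨ cong (x +_) (*-assoc x b _) ⟩
    x + x * N b            ≡⟨ cong (λ t → x + x * t) Nb≡-1 ⟩
    x + x * - 1#           ≡⟨ cong (x +_) (x*-1≡-x x) ⟩
    x - x                  ≡⟨ -‿inverseʳ x ⟩
    0#                     ∎)
    where
    b = y * x⁻¹
    xb≡y : x * b ≡ y
    xb≡y = begin
      x * (y * x⁻¹)   ≡⟨ *-CS.x∙yz≈y∙xz x y x⁻¹ ⟩
      y * (x * x⁻¹)   ≡⟨ cong (y *_) xx⁻¹≡1 ⟩
      y * 1#          ≡⟨ *-identityʳ y ⟩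
      y               ∎
    Nb≡-1 : N b ≡ - 1#
    Nb≡-1 = begin
      N (y * x⁻¹)          ≡⟨ ^-distrib-* y x⁻¹ (suc r) ⟩
      N y * N x⁻¹          ≡⟨ cong (_* N x⁻¹) (+-inverseʳ-unique (N x) (N y) Nx+Ny≡0) ⟩
      - N x * N x⁻¹        ≡⟨ -‿distribˡ-* (N x) (N x⁻¹) ⟨
      - (N x * N x⁻¹)      ≡⟨ cong -_ (^-distrib-* x x⁻¹ (suc r)) ⟨
      - N (x * x⁻¹)        ≡⟨ cong (λ t → - N t) xx⁻¹≡1 ⟩
      - N 1#               ≡⟨ cong -_ (1^n≡1 (suc r)) ⟩
      - 1#                 ∎

  isotropic-orthogonal⇒≡ : ∀ {b c} → N b ≡ - 1# → N c ≡ - 1# → 1# + c * b ^ r ≡ 0# → b ≡ c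
  isotropic-orthogonal⇒≡ {b} {c} Nb≡-1 Nc≡-1 ⊥b = orthogonal-unique (λ eq → 1≢0 (cong proj₁ eq)) Nb≡-1 Nc≡-1 ⊥b
    (trans (cong (1# +_) Nc≡-1) (-‿inverseʳ 1#))

  -- The points [1 : b] with N b ≡ -1 are the isotropic points of the hyperbolic line ⟨e₁, e₂⟩,
  -- and x + y * b ^ r is the Hermitian product of (x, y) with (1, b).
  isotropic⊥ : Fin q → Fin q → Fin q → Bool
  isotropic⊥ x y b = (N b == - 1#) ∧ (x + y * b ^ r == 0#)

  count-isotropic⊥ : ∀ {x y} → (x , y) ≢ (0# , 0#) →
                     count (isotropic⊥ x y) (allFin q) ≡ (if N x + N y == 0# then 1 else 0)
  count-isotropic⊥ {x} {y} xy≢0 with N x + N y Fin.≟ 0#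
  ... | yes Nx+Ny≡0 with orthogonal-exists xy≢0 Nx+Ny≡0
  ...   | b , Nb≡-1 , ⊥b = count-≡1 (allFin⁺ q) (∈-allFin b) (cong₂ _∧_ (≡⇒==-true Nb≡-1) (≡⇒==-true ⊥b))
      λ b′ ⊥b′ → orthogonal-unique xy≢0 (==-true⇒≡ (∧-conicalˡ _ _ ⊥b′)) Nb≡-1 (==-true⇒≡ (∧-conicalʳ _ _ ⊥b′)) ⊥b
  count-isotropic⊥ {x} {y} xy≢0 | no Nx+Ny≢0 = count-≡0 (allFin q) not-isotropic⊥
    where
    not-isotropic⊥ : ∀ b → isotropic⊥ x y b ≡ false
    not-isotropic⊥ b with isotropic⊥ x y b in ⊥b
    ... | false = refl
    ... | true  = contradiction
      (orthogonal⇒N-sum≡0 (==-true⇒≡ (∧-conicalˡ _ _ ⊥b)) (==-true⇒≡ (∧-conicalʳ _ _ ⊥b))) Nx+Ny≢0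

module UnitaryPolarGraphProperties {q : ℕ} (F : FiniteField q) (r : ℕ) (q≡r*r : q ≡ r ℕ.* r) where
  open FieldProperties F
  open HyperbolicLine F r
  open PowerEquations F using (count-x^[1+r]≡-1)
  open UnitaryPolarGraph F r hiding (_==_; pow)
  open BooleanEquality {Vector} (VecP.≡-dec Fin._≟_) using ()
    renaming (_==_ to _==ᵛ_; ≡⇒==-true to ≡⇒==ᵛ-true; ≢⇒==-false to ≢⇒==ᵛ-false; ==-true⇒≡ to ==ᵛ-true⇒≡)
  open ≡-Reasoning

  private
    0^r≡0 : 0# ^ r ≡ 0#
    0^r≡0 = 0^n≡0 r λ r≡0 → contradiction (subst (2 ℕ.≤_) (trans q≡r*r (cong (λ n → n ℕ.* n) r≡0)) 2≤q) λ ()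

    pow≡^ : ∀ x n → UnitaryPolarGraph.pow F r x n ≡ x ^ n
    pow≡^ x zero    = refl
    pow≡^ x (suc n) = cong (x *_) (pow≡^ x n)

  H-split : ∀ x₀ x₁ x₂ x₃ y₀ y₁ y₂ y₃ → H (x₀ ∷ x₁ ∷ x₂ ∷ x₃ ∷ []) (y₀ ∷ y₁ ∷ y₂ ∷ y₃ ∷ []) ≡
            (x₀ * y₀ ^ r + x₁ * y₁ ^ r) + (x₂ * y₂ ^ r + x₃ * y₃ ^ r)
  H-split x₀ x₁ x₂ x₃ y₀ y₁ y₂ y₃
    rewrite pow≡^ y₀ r | pow≡^ y₁ r | pow≡^ y₂ r | pow≡^ y₃ r | +-identityʳ (x₃ * y₃ ^ r) =
    sym (+-assoc (x₀ * y₀ ^ r) _ _)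

  H-self : ∀ x₀ x₁ x₂ x₃ →
           H (x₀ ∷ x₁ ∷ x₂ ∷ x₃ ∷ []) (x₀ ∷ x₁ ∷ x₂ ∷ x₃ ∷ []) ≡ (N x₀ + N x₁) + (N x₂ + N x₃)
  H-self x₀ x₁ x₂ x₃ = H-split x₀ x₁ x₂ x₃ x₀ x₁ x₂ x₃

  private
    x*1^r+y*b^r : ∀ x y b → x * 1# ^ r + y * b ^ r ≡ x + y * b ^ r
    x*1^r+y*b^r x y b = cong (_+ y * b ^ r) (trans (cong (x *_) (1^n≡1 r)) (*-identityʳ x))

    x*0^r+y*0^r : ∀ x y → x * 0# ^ r + y * 0# ^ r ≡ 0#
    x*0^r+y*0^r x y = begin
      x * 0# ^ r + y * 0# ^ r  ≡⟨ cong₂ (λ s t → x * s + y * t) 0^r≡0 0^r≡0 ⟩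
      x * 0# + y * 0#          ≡⟨ cong₂ _+_ (zeroʳ x) (zeroʳ y) ⟩
      0# + 0#                  ≡⟨ +-identityʳ 0# ⟩
      0#                       ∎

  -- The isotropic points of the hyperbolic lines ⟨e₁, e₂⟩ and ⟨e₃, e₄⟩ are the points
  -- pointA b and pointB b with N b ≡ -1; these lines are orthogonal to each other.
  pointA pointB : Fin q → Vector
  pointA b = 1# ∷ b ∷ 0# ∷ 0# ∷ []
  pointB b = 0# ∷ 0# ∷ 1# ∷ b ∷ []

  onA onB : Vector → Bool
  onA v@(_ ∷ b ∷ _ ∷ _ ∷ []) = v ==ᵛ pointA b
  onB v@(_ ∷ _ ∷ _ ∷ b ∷ []) = v ==ᵛ pointB b

  H-pointA : ∀ z₀ z₁ z₂ z₃ b → H (z₀ ∷ z₁ ∷ z₂ ∷ z₃ ∷ []) (pointA b) ≡ z₀ + z₁ * b ^ r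
  H-pointA z₀ z₁ z₂ z₃ b = begin
    H (z₀ ∷ z₁ ∷ z₂ ∷ z₃ ∷ []) (pointA b)
      ≡⟨ H-split z₀ z₁ z₂ z₃ 1# b 0# 0# ⟩
    (z₀ * 1# ^ r + z₁ * b ^ r) + (z₂ * 0# ^ r + z₃ * 0# ^ r)
      ≡⟨ cong₂ _+_ (x*1^r+y*b^r z₀ z₁ b) (x*0^r+y*0^r z₂ z₃) ⟩
    (z₀ + z₁ * b ^ r) + 0#
      ≡⟨ +-identityʳ _ ⟩
    z₀ + z₁ * b ^ r  ∎

  H-pointB : ∀ z₀ z₁ z₂ z₃ b → H (z₀ ∷ z₁ ∷ z₂ ∷ z₃ ∷ []) (pointB b) ≡ z₂ + z₃ * b ^ r
  H-pointB z₀ z₁ z₂ z₃ b = begin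
    H (z₀ ∷ z₁ ∷ z₂ ∷ z₃ ∷ []) (pointB b)
      ≡⟨ H-split z₀ z₁ z₂ z₃ 0# 0# 1# b ⟩
    (z₀ * 0# ^ r + z₁ * 0# ^ r) + (z₂ * 1# ^ r + z₃ * b ^ r)
      ≡⟨ cong₂ _+_ (x*0^r+y*0^r z₀ z₁) (x*1^r+y*b^r z₂ z₃ b) ⟩
    0# + (z₂ + z₃ * b ^ r)
      ≡⟨ +-identityˡ _ ⟩
    z₂ + z₃ * b ^ r  ∎

  onA-pointA : ∀ b → onA (pointA b) ≡ true
  onA-pointA b = ≡⇒==ᵛ-true refl

  onB-pointB : ∀ b → onB (pointB b) ≡ true
  onB-pointB b = ≡⇒==ᵛ-true refl

  onA-pointB : ∀ b → onA (pointB b) ≡ false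
  onA-pointB b = ≢⇒==ᵛ-false (0≢1 ∘ proj₁ ∘ ∷-injective)

  onB-pointA : ∀ b → onB (pointA b) ≡ false
  onB-pointA b = ≢⇒==ᵛ-false (1≢0 ∘ proj₁ ∘ ∷-injective)

  private
    1+x==0≡x==-1 : ∀ x → (1# + x == 0#) ≡ (x == - 1#)
    1+x==0≡x==-1 x = ==-cong-⇔ (+-inverseʳ-unique 1# x) (λ x≡-1 → trans (cong (1# +_) x≡-1) (-‿inverseʳ 1#))

    normalised-0∷ : ∀ {n} (xs : Vec (Fin q) n) → normalisedᵇ (0# ∷ xs) ≡ normalisedᵇ xs
    normalised-0∷ xs rewrite ≡⇒==-true {0#} refl = refl

  isVertex-pointA : ∀ b → isVertexᵇ (pointA b) ≡ (N b == - 1#)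
  isVertex-pointA b rewrite ≢⇒==-false 1≢0 | ≡⇒==-true {1#} refl =
    trans (cong (_== 0#) (H-pointA 1# b 0# 0# b)) (1+x==0≡x==-1 (N b))

  isVertex-pointB : ∀ b → isVertexᵇ (pointB b) ≡ (N b == - 1#)
  isVertex-pointB b = begin
    normalisedᵇ (pointB b) ∧ (H (pointB b) (pointB b) == 0#)
      ≡⟨ cong₂ _∧_ normalised-pointB (cong (_== 0#) (H-pointB 0# 0# 1# b b)) ⟩
    true ∧ (1# + b * b ^ r == 0#)
      ≡⟨ 1+x==0≡x==-1 (N b) ⟩
    N b == - 1#  ∎
    where
    normalised-pointB : normalisedᵇ (pointB b) ≡ true
    normalised-pointB = begin
      normalisedᵇ (0# ∷ 0# ∷ 1# ∷ b ∷ [])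
        ≡⟨ normalised-0∷ (0# ∷ 1# ∷ b ∷ []) ⟩
      normalisedᵇ (0# ∷ 1# ∷ b ∷ [])
        ≡⟨ normalised-0∷ (1# ∷ b ∷ []) ⟩
      normalisedᵇ (1# ∷ b ∷ [])
        ≡⟨ cong (λ t → if t then normalisedᵇ (b ∷ []) else (1# == 1#)) (≢⇒==-false 1≢0) ⟩
      1# == 1#
        ≡⟨ ≡⇒==-true refl ⟩
      true  ∎

  count-vertices : ∀ (p : Vector → Bool) → count (p ∘ proj₁) vertices ≡ count (λ v → isVertexᵇ v ∧ p v) (allVecs 4)
  count-vertices p = trans (count-mapMaybe toVertex (allVecs 4)) (count-cong (allVecs 4) counted-once)
    where
    counted-once : ∀ v → maybe (p ∘ proj₁) false (toVertex v) ≡ isVertexᵇ v ∧ p v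
    counted-once v with T? (isVertexᵇ v)
    ... | yes isV = cong (_∧ p v) (sym (Equivalence.to T-≡ isV))
    ... | no ¬isV = cong (_∧ p v) (sym (¬T⇒≡false ¬isV))
      where
      ¬T⇒≡false : ∀ {b} → ¬ T b → b ≡ false
      ¬T⇒≡false {false} _  = refl
      ¬T⇒≡false {true}  ¬t = contradiction _ ¬t

  private
    count-allVecs : ∀ {n} (P : Vec (Fin q) (suc n) → Bool) →
                    count P (allVecs (suc n)) ≡ sum (map (λ x → count (P ∘ (x ∷_)) (allVecs n)) (allFin q))
    count-allVecs {n} P = trans (count-concatMap _ (allFin q))
      (cong sum (map-cong (λ x → count-map (x ∷_) (allVecs n)) (allFin q)))

    count-allVecs-fixed : ∀ {n} (P : Vec (Fin q) (suc n) → Bool) c → (∀ x v → x ≢ c → P (x ∷ v) ≡ false) →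
                          count P (allVecs (suc n)) ≡ count (P ∘ (c ∷_)) (allVecs n)
    count-allVecs-fixed {n} P c P-fixed = trans (count-allVecs P)
      (sum-map-single _ (allFin⁺ q) (∈-allFin c) λ x x≢c → count-≡0 (allVecs n) λ v → P-fixed x v x≢c)

  count-onA : ∀ (p : Vector → Bool) → count (λ v → p v ∧ onA v) (allVecs 4) ≡ count (p ∘ pointA) (allFin q)
  count-onA p = begin
    count P (allVecs 4)
      ≡⟨ count-allVecs-fixed P 1# (λ { x (b ∷ y ∷ w ∷ []) x≢1 → off-A (x≢1 ∘ proj₁) }) ⟩
    count (P ∘ (1# ∷_)) (allVecs 3)
      ≡⟨ count-allVecs _ ⟩
    sum (map (λ b → count (P ∘ (1# ∷_) ∘ (b ∷_)) (allVecs 2)) (allFin q))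
      ≡⟨ cong sum (map-cong fixed-zeros (allFin q)) ⟩
    sum (map (λ b → if P (pointA b) then 1 else 0) (allFin q))
      ≡⟨ sum-indicator (allFin q) ⟩
    count (P ∘ pointA) (allFin q)
      ≡⟨ count-cong (allFin q) (λ b → trans (cong (p (pointA b) ∧_) (onA-pointA b)) (∧-identityʳ _)) ⟩
    count (p ∘ pointA) (allFin q)  ∎
    where
    P = λ v → p v ∧ onA v
    off-A : ∀ {x b y w} → ¬ (x ≡ 1# × y ≡ 0# × w ≡ 0#) → P (x ∷ b ∷ y ∷ w ∷ []) ≡ false
    off-A ¬onA = trans (cong (p _ ∧_) (≢⇒==ᵛ-false λ { refl → ¬onA (refl , refl , refl) })) (∧-zeroʳ _)
    fixed-zeros : ∀ b → count (P ∘ (1# ∷_) ∘ (b ∷_)) (allVecs 2) ≡ (if P (pointA b) then 1 else 0)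
    fixed-zeros b = trans (count-allVecs-fixed _ 0# (λ { y (w ∷ []) y≢0 → off-A (y≢0 ∘ proj₁ ∘ proj₂) }))
                          (count-allVecs-fixed _ 0# (λ { w [] w≢0 → off-A (w≢0 ∘ proj₂ ∘ proj₂) }))

  count-onB : ∀ (p : Vector → Bool) → count (λ v → p v ∧ onB v) (allVecs 4) ≡ count (p ∘ pointB) (allFin q)
  count-onB p = begin
    count P (allVecs 4)
      ≡⟨ count-allVecs-fixed P 0# (λ { x (y ∷ z ∷ w ∷ []) x≢0 → off-B (x≢0 ∘ proj₁) }) ⟩
    count (P ∘ (0# ∷_)) (allVecs 3)
      ≡⟨ count-allVecs-fixed _ 0# (λ { y (z ∷ w ∷ []) y≢0 → off-B (y≢0 ∘ proj₁ ∘ proj₂) }) ⟩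
    count (P ∘ (0# ∷_) ∘ (0# ∷_)) (allVecs 2)
      ≡⟨ count-allVecs-fixed _ 1# (λ { z (w ∷ []) z≢1 → off-B (z≢1 ∘ proj₂ ∘ proj₂) }) ⟩
    count (P ∘ (0# ∷_) ∘ (0# ∷_) ∘ (1# ∷_)) (allVecs 1)
      ≡⟨ count-allVecs _ ⟩
    sum (map (λ b → if P (pointB b) then 1 else 0) (allFin q))
      ≡⟨ sum-indicator (allFin q) ⟩
    count (P ∘ pointB) (allFin q)
      ≡⟨ count-cong (allFin q) (λ b → trans (cong (p (pointB b) ∧_) (onB-pointB b)) (∧-identityʳ _)) ⟩
    count (p ∘ pointB) (allFin q)  ∎
    where
    P = λ v → p v ∧ onB v
    off-B : ∀ {x y z b} → ¬ (x ≡ 0# × y ≡ 0# × z ≡ 1#) → P (x ∷ y ∷ z ∷ b ∷ []) ≡ false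
    off-B ¬onB = trans (cong (p _ ∧_) (≢⇒==ᵛ-false λ { refl → ¬onB (refl , refl , refl) })) (∧-zeroʳ _)

  count-vertices-onA : ∀ (p : Vector → Bool) →
    count (λ γ → p (proj₁ γ) ∧ onA (proj₁ γ)) vertices ≡ count (λ b → (N b == - 1#) ∧ p (pointA b)) (allFin q)
  count-vertices-onA p = begin
    count (λ γ → p (proj₁ γ) ∧ onA (proj₁ γ)) vertices
      ≡⟨ count-vertices (λ v → p v ∧ onA v) ⟩
    count (λ v → isVertexᵇ v ∧ (p v ∧ onA v)) (allVecs 4)
      ≡⟨ count-cong (allVecs 4) (λ v → sym (∧-assoc (isVertexᵇ v) (p v) (onA v))) ⟩
    count (λ v → (isVertexᵇ v ∧ p v) ∧ onA v) (allVecs 4)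
      ≡⟨ count-onA (λ v → isVertexᵇ v ∧ p v) ⟩
    count (λ b → isVertexᵇ (pointA b) ∧ p (pointA b)) (allFin q)
      ≡⟨ count-cong (allFin q) (λ b → cong (_∧ p (pointA b)) (isVertex-pointA b)) ⟩
    count (λ b → (N b == - 1#) ∧ p (pointA b)) (allFin q)  ∎

  count-vertices-onB : ∀ (p : Vector → Bool) →
    count (λ γ → p (proj₁ γ) ∧ onB (proj₁ γ)) vertices ≡ count (λ b → (N b == - 1#) ∧ p (pointB b)) (allFin q)
  count-vertices-onB p = begin
    count (λ γ → p (proj₁ γ) ∧ onB (proj₁ γ)) vertices
      ≡⟨ count-vertices (λ v → p v ∧ onB v) ⟩
    count (λ v → isVertexᵇ v ∧ (p v ∧ onB v)) (allVecs 4)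
      ≡⟨ count-cong (allVecs 4) (λ v → sym (∧-assoc (isVertexᵇ v) (p v) (onB v))) ⟩
    count (λ v → (isVertexᵇ v ∧ p v) ∧ onB v) (allVecs 4)
      ≡⟨ count-onB (λ v → isVertexᵇ v ∧ p v) ⟩
    count (λ b → isVertexᵇ (pointB b) ∧ p (pointB b)) (allFin q)
      ≡⟨ count-cong (allFin q) (λ b → cong (_∧ p (pointB b)) (isVertex-pointB b)) ⟩
    count (λ b → (N b == - 1#) ∧ p (pointB b)) (allFin q)  ∎

  adjacent : Vector → Vector → Bool
  adjacent z u = not (z ==ᵛ u) ∧ (H z u == 0#)

  neighboursOnA neighboursOnB : Vector → ℕ
  neighboursOnA z = count (λ b → (N b == - 1#) ∧ adjacent z (pointA b)) (allFin q)
  neighboursOnB z = count (λ b → (N b == - 1#) ∧ adjacent z (pointB b)) (allFin q)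

  private
    adjacent-≢ : ∀ {z u} → z ≢ u → adjacent z u ≡ (H z u == 0#)
    adjacent-≢ {z} {u} z≢u = cong (λ t → not t ∧ (H z u == 0#)) (≢⇒==ᵛ-false z≢u)

    non-adjacent : ∀ {b z u} → (N b ≡ - 1# → H z u ≡ 0# → z ≡ u) → ((N b == - 1#) ∧ adjacent z u) ≡ false
    non-adjacent {b} {z} {u} ⊥⇒≡ with N b Fin.≟ - 1# | H z u Fin.≟ 0#
    ... | yes Nb≡-1 | yes ⊥ = trans (∧-identityʳ _) (cong not (≡⇒==ᵛ-true (⊥⇒≡ Nb≡-1 ⊥)))
    ... | yes _     | no _  = ∧-zeroʳ _
    ... | no _      | _     = refl

    adjacent-to-all : ∀ {z} (point : Fin q → Vector) → (∀ b → z ≢ point b) → (∀ b → H z (point b) ≡ 0#) →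
                      count (λ b → (N b == - 1#) ∧ adjacent z (point b)) (allFin q) ≡ suc r
    adjacent-to-all point z≢point z⊥point = trans
      (count-cong (allFin q) λ b →
        trans (cong ((N b == - 1#) ∧_) (trans (adjacent-≢ (z≢point b)) (≡⇒==-true (z⊥point b)))) (∧-identityʳ _))
      (count-x^[1+r]≡-1 r q≡r*r)

    onA-false⇒≢pointA : ∀ {z b} → onA z ≡ false → z ≢ pointA b
    onA-false⇒≢pointA {b = b} onA≡false refl = contradiction (trans (sym (onA-pointA b)) onA≡false) λ ()

    onB-false⇒≢pointB : ∀ {z b} → onB z ≡ false → z ≢ pointB b
    onB-false⇒≢pointB {b = b} onB≡false refl = contradiction (trans (sym (onB-pointB b)) onB≡false) λ ()

  neighboursOnA-pointA : ∀ c → N c ≡ - 1# → neighboursOnA (pointA c) ≡ 0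
  neighboursOnA-pointA c Nc≡-1 = count-≡0 (allFin q) λ b → non-adjacent λ Nb≡-1 ⊥ →
    cong pointA (sym (isotropic-orthogonal⇒≡ Nb≡-1 Nc≡-1 (trans (sym (H-pointA 1# c 0# 0# b)) ⊥)))

  neighboursOnB-pointB : ∀ c → N c ≡ - 1# → neighboursOnB (pointB c) ≡ 0
  neighboursOnB-pointB c Nc≡-1 = count-≡0 (allFin q) λ b → non-adjacent λ Nb≡-1 ⊥ →
    cong pointB (sym (isotropic-orthogonal⇒≡ Nb≡-1 Nc≡-1 (trans (sym (H-pointB 0# 0# 1# c b)) ⊥)))

  neighboursOnB-pointA : ∀ c → neighboursOnB (pointA c) ≡ suc r
  neighboursOnB-pointA c = adjacent-to-all pointB (λ _ → 1≢0 ∘ proj₁ ∘ ∷-injective) λ b →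
    trans (H-pointB 1# c 0# 0# b) (trans (+-identityˡ _) (zeroˡ _))

  neighboursOnA-pointB : ∀ c → neighboursOnA (pointB c) ≡ suc r
  neighboursOnA-pointB c = adjacent-to-all pointA (λ _ → 0≢1 ∘ proj₁ ∘ ∷-injective) λ b →
    trans (H-pointA 0# 0# 1# c b) (trans (+-identityˡ _) (zeroˡ _))

  neighboursOnA-off : ∀ z₀ z₁ z₂ z₃ → onA (z₀ ∷ z₁ ∷ z₂ ∷ z₃ ∷ []) ≡ false →
                      neighboursOnA (z₀ ∷ z₁ ∷ z₂ ∷ z₃ ∷ []) ≡ count (isotropic⊥ z₀ z₁) (allFin q)
  neighboursOnA-off z₀ z₁ z₂ z₃ onA≡false = count-cong (allFin q) λ b → cong ((N b == - 1#) ∧_)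
    (trans (adjacent-≢ (onA-false⇒≢pointA onA≡false)) (cong (_== 0#) (H-pointA z₀ z₁ z₂ z₃ b)))

  neighboursOnB-off : ∀ z₀ z₁ z₂ z₃ → onB (z₀ ∷ z₁ ∷ z₂ ∷ z₃ ∷ []) ≡ false →
                      neighboursOnB (z₀ ∷ z₁ ∷ z₂ ∷ z₃ ∷ []) ≡ count (isotropic⊥ z₂ z₃) (allFin q)
  neighboursOnB-off z₀ z₁ z₂ z₃ onB≡false = count-cong (allFin q) λ b → cong ((N b == - 1#) ∧_)
    (trans (adjacent-≢ (onB-false⇒≢pointB onB≡false)) (cong (_== 0#) (H-pointB z₀ z₁ z₂ z₃ b)))

  private
    normalised-pair : ∀ {n} x y (rest : Vec (Fin q) n) → normalisedᵇ (x ∷ y ∷ rest) ≡ true →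
                      normalisedᵇ rest ≡ false → N x + N y ≡ 0# → x ≡ 1#
    normalised-pair x y rest norm ¬norm Nx+Ny≡0 with x Fin.≟ 0#
    ... | no _    = ==-true⇒≡ norm
    ... | yes x≡0 with N-sum≡0⇒x≡0⇒y≡0 Nx+Ny≡0 x≡0
    ...   | refl = contradiction (trans (sym ¬norm) (trans (sym (normalised-0∷ rest)) norm)) λ ()

    N0+N0≡0 : N 0# + N 0# ≡ 0#
    N0+N0≡0 = trans (cong₂ _+_ (0^n≡0 (suc r) λ ()) (0^n≡0 (suc r) λ ())) (+-identityʳ 0#)

    isotropic : ∀ z₀ z₁ z₂ z₃ → isVertexᵇ (z₀ ∷ z₁ ∷ z₂ ∷ z₃ ∷ []) ≡ true →
                (N z₀ + N z₁) + (N z₂ + N z₃) ≡ 0#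
    isotropic z₀ z₁ z₂ z₃ isV = trans (sym (H-self z₀ z₁ z₂ z₃)) (==-true⇒≡ (∧-conicalʳ _ _ isV))

    off-B⇒top≢0 : ∀ z₀ z₁ z₂ z₃ → isVertexᵇ (z₀ ∷ z₁ ∷ z₂ ∷ z₃ ∷ []) ≡ true →
                  onB (z₀ ∷ z₁ ∷ z₂ ∷ z₃ ∷ []) ≡ false → (z₀ , z₁) ≢ (0# , 0#)
    off-B⇒top≢0 _ _ z₂ z₃ isV onB≡false refl =
      onB-false⇒≢pointB onB≡false (cong (λ t → 0# ∷ 0# ∷ t ∷ z₃ ∷ [])
        (normalised-pair z₂ z₃ [] normalised refl isotropic′))
      where
      normalised : normalisedᵇ (z₂ ∷ z₃ ∷ []) ≡ true
      normalised = trans (sym (trans (normalised-0∷ (0# ∷ z₂ ∷ z₃ ∷ [])) (normalised-0∷ (z₂ ∷ z₃ ∷ []))))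
                         (∧-conicalˡ _ _ isV)
      isotropic′ : N z₂ + N z₃ ≡ 0#
      isotropic′ = trans (sym (+-identityˡ _))
                         (trans (cong (_+ (N z₂ + N z₃)) (sym N0+N0≡0)) (isotropic 0# 0# z₂ z₃ isV))

    off-A⇒bottom≢0 : ∀ z₀ z₁ z₂ z₃ → isVertexᵇ (z₀ ∷ z₁ ∷ z₂ ∷ z₃ ∷ []) ≡ true →
                     onA (z₀ ∷ z₁ ∷ z₂ ∷ z₃ ∷ []) ≡ false → (z₂ , z₃) ≢ (0# , 0#)
    off-A⇒bottom≢0 z₀ z₁ _ _ isV onA≡false refl =
      onA-false⇒≢pointA onA≡false (cong (λ t → t ∷ z₁ ∷ 0# ∷ 0# ∷ [])
        (normalised-pair z₀ z₁ (0# ∷ 0# ∷ []) (∧-conicalˡ _ _ isV) ¬normalised isotropic′))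
      where
      ¬normalised : normalisedᵇ (0# ∷ 0# ∷ []) ≡ false
      ¬normalised = trans (normalised-0∷ (0# ∷ [])) (normalised-0∷ [])
      isotropic′ : N z₀ + N z₁ ≡ 0#
      isotropic′ = trans (sym (+-identityʳ _))
                         (trans (cong ((N z₀ + N z₁) +_) (sym N0+N0≡0)) (isotropic z₀ z₁ 0# 0# isV))

  weight : Vector → ℚ
  weight v = χ (onA v) ℚ.- χ (onB v)

  EigenEquationAt : Vector → Set
  EigenEquationAt z = ℚ.- ⟦ suc r ⟧ ℚ.* weight z ≡ ⟦ neighboursOnA z ⟧ ℚ.- ⟦ neighboursOnB z ⟧

  private
    eigen-pointA : ∀ c → N c ≡ - 1# → EigenEquationAt (pointA c)
    eigen-pointA c Nc≡-1 = begin
      ℚ.- ⟦ suc r ⟧ ℚ.* weight (pointA c)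
        ≡⟨ cong (λ w → ℚ.- ⟦ suc r ⟧ ℚ.* w) (cong₂ (λ a b → χ a ℚ.- χ b) (onA-pointA c) (onB-pointA c)) ⟩
      ℚ.- ⟦ suc r ⟧ ℚ.* (1ℚ ℚ.- 0ℚ)
        ≡⟨ solve 1 (λ n → :- n :* (con 1ℚ :- con 0ℚ) := con 0ℚ :- n) refl ⟦ suc r ⟧ ⟩
      ⟦ 0 ⟧ ℚ.- ⟦ suc r ⟧
        ≡⟨ cong₂ (λ m n → ⟦ m ⟧ ℚ.- ⟦ n ⟧) (neighboursOnA-pointA c Nc≡-1) (neighboursOnB-pointA c) ⟨
      ⟦ neighboursOnA (pointA c) ⟧ ℚ.- ⟦ neighboursOnB (pointA c) ⟧ ∎

    eigen-pointB : ∀ c → N c ≡ - 1# → EigenEquationAt (pointB c)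
    eigen-pointB c Nc≡-1 = begin
      ℚ.- ⟦ suc r ⟧ ℚ.* weight (pointB c)
        ≡⟨ cong (λ w → ℚ.- ⟦ suc r ⟧ ℚ.* w) (cong₂ (λ a b → χ a ℚ.- χ b) (onA-pointB c) (onB-pointB c)) ⟩
      ℚ.- ⟦ suc r ⟧ ℚ.* (0ℚ ℚ.- 1ℚ)
        ≡⟨ solve 1 (λ n → :- n :* (con 0ℚ :- con 1ℚ) := n :- con 0ℚ) refl ⟦ suc r ⟧ ⟩
      ⟦ suc r ⟧ ℚ.- ⟦ 0 ⟧
        ≡⟨ cong₂ (λ m n → ⟦ m ⟧ ℚ.- ⟦ n ⟧) (neighboursOnA-pointB c) (neighboursOnB-pointB c Nc≡-1) ⟨
      ⟦ neighboursOnA (pointB c) ⟧ ℚ.- ⟦ neighboursOnB (pointB c) ⟧ ∎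

    -- Off the two lines, z has exactly one neighbour on each line or none on either, because
    -- the two norm sums below add up to 0.
    eigen-off : ∀ z₀ z₁ z₂ z₃ → let z = z₀ ∷ z₁ ∷ z₂ ∷ z₃ ∷ [] in
                isVertexᵇ z ≡ true → onA z ≡ false → onB z ≡ false → EigenEquationAt z
    eigen-off z₀ z₁ z₂ z₃ isV onA≡false onB≡false = begin
      ℚ.- ⟦ suc r ⟧ ℚ.* weight z
        ≡⟨ cong (λ w → ℚ.- ⟦ suc r ⟧ ℚ.* w) (cong₂ (λ a b → χ a ℚ.- χ b) onA≡false onB≡false) ⟩
      ℚ.- ⟦ suc r ⟧ ℚ.* (0ℚ ℚ.- 0ℚ)
        ≡⟨ solve 2 (λ n m → :- n :* (con 0ℚ :- con 0ℚ) := m :- m) refl ⟦ suc r ⟧ ⟦ neighboursOnA z ⟧ ⟩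
      ⟦ neighboursOnA z ⟧ ℚ.- ⟦ neighboursOnA z ⟧
        ≡⟨ cong (λ n → ⟦ neighboursOnA z ⟧ ℚ.- ⟦ n ⟧) equal-counts ⟩
      ⟦ neighboursOnA z ⟧ ℚ.- ⟦ neighboursOnB z ⟧ ∎
      where
      z = z₀ ∷ z₁ ∷ z₂ ∷ z₃ ∷ []
      equal-counts : neighboursOnA z ≡ neighboursOnB z
      equal-counts = begin
        neighboursOnA z
          ≡⟨ neighboursOnA-off z₀ z₁ z₂ z₃ onA≡false ⟩
        count (isotropic⊥ z₀ z₁) (allFin q)
          ≡⟨ count-isotropic⊥ (off-B⇒top≢0 z₀ z₁ z₂ z₃ isV onB≡false) ⟩
        (if N z₀ + N z₁ == 0# then 1 else 0)
          ≡⟨ cong (λ t → if t then 1 else 0) (x+y≡0⇒[x==0]≡[y==0] (isotropic z₀ z₁ z₂ z₃ isV)) ⟩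
        (if N z₂ + N z₃ == 0# then 1 else 0)
          ≡⟨ count-isotropic⊥ (off-A⇒bottom≢0 z₀ z₁ z₂ z₃ isV onA≡false) ⟨
        count (isotropic⊥ z₂ z₃) (allFin q)
          ≡⟨ neighboursOnB-off z₀ z₁ z₂ z₃ onB≡false ⟨
        neighboursOnB z  ∎

  eigen-equation : ∀ z → isVertexᵇ z ≡ true → EigenEquationAt z
  eigen-equation z@(z₀ ∷ z₁ ∷ z₂ ∷ z₃ ∷ []) isV = by-position (onA z) (onB z) refl refl
    where
    -- Not a with on onA z: abstracting it in EigenEquationAt z makes Agda normalise the neighbour counts.
    by-position : ∀ a b → onA z ≡ a → onB z ≡ b → EigenEquationAt z
    by-position true _ onA≡true _ = subst EigenEquationAt (sym z≡pointA) (eigen-pointA z₁ (==-true⇒≡ (begin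
      N z₁ == - 1#           ≡⟨ isVertex-pointA z₁ ⟨
      isVertexᵇ (pointA z₁)  ≡⟨ cong isVertexᵇ z≡pointA ⟨
      isVertexᵇ z            ≡⟨ isV ⟩
      true                   ∎)))
      where z≡pointA = ==ᵛ-true⇒≡ onA≡true
    by-position false true _ onB≡true = subst EigenEquationAt (sym z≡pointB) (eigen-pointB z₃ (==-true⇒≡ (begin
      N z₃ == - 1#           ≡⟨ isVertex-pointB z₃ ⟨
      isVertexᵇ (pointB z₃)  ≡⟨ cong isVertexᵇ z≡pointB ⟨
      isVertexᵇ z            ≡⟨ isV ⟩
      true                   ∎)))
      where z≡pointB = ==ᵛ-true⇒≡ onB≡true
    by-position false false onA≡false onB≡false = eigen-off z₀ z₁ z₂ z₃ isV onA≡false onB≡false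

  eigenfunction : Vertex → ℚ
  eigenfunction γ = weight (proj₁ γ)

  private
    onA∧onB≡false : ∀ v → (onA v ∧ onB v) ≡ false
    onA∧onB≡false v@(z₀ ∷ z₁ ∷ z₂ ∷ z₃ ∷ []) = by-position (onA v) refl
      where
      by-position : ∀ a → onA v ≡ a → (a ∧ onB v) ≡ false
      by-position false _        = refl
      by-position true  onA≡true = trans (cong onB (==ᵛ-true⇒≡ onA≡true)) (onB-pointA z₁)

    #A : count (onA ∘ proj₁) vertices ≡ suc r
    #B : count (onB ∘ proj₁) vertices ≡ suc r
    #A = trans (count-vertices-onA (λ _ → true))
               (trans (count-cong (allFin q) (λ b → ∧-identityʳ _)) (count-x^[1+r]≡-1 r q≡r*r))
    #B = trans (count-vertices-onB (λ _ → true))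
               (trans (count-cong (allFin q) (λ b → ∧-identityʳ _)) (count-x^[1+r]≡-1 r q≡r*r))

  eigenfunction-nonzero : ∃ λ γ → eigenfunction γ ≢ 0ℚ
  eigenfunction-nonzero with count-suc⇒∃ (allFin q) (count-x^[1+r]≡-1 r q≡r*r)
  ... | b , Nb==-1 = (pointA b , Equivalence.from T-≡ (trans (isVertex-pointA b) Nb==-1)) ,
    λ f≡0 → contradiction (trans (sym (cong₂ (λ a b → χ a ℚ.- χ b) (onA-pointA b) (onB-pointA b))) f≡0) λ ()

  eigenfunction-support : length (filter (λ γ → ¬? (eigenfunction γ ≟ 0ℚ)) vertices) ≡ 2 ℕ.* suc r
  eigenfunction-support = begin
    length (filter (λ γ → ¬? (eigenfunction γ ≟ 0ℚ)) vertices)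
      ≡⟨ length-filter (λ γ → ¬? (eigenfunction γ ≟ 0ℚ)) vertices ⟩
    count (λ γ → does (¬? (eigenfunction γ ≟ 0ℚ))) vertices
      ≡⟨ count-cong vertices (λ γ → χ-χ≢0 (onA (proj₁ γ)) (onB (proj₁ γ))) ⟩
    count (λ γ → onA (proj₁ γ) xor onB (proj₁ γ)) vertices
      ≡⟨ count-xor vertices (onA∧onB≡false ∘ proj₁) ⟩
    count (onA ∘ proj₁) vertices ℕ.+ count (onB ∘ proj₁) vertices
      ≡⟨ cong₂ ℕ._+_ #A #B ⟩
    suc r ℕ.+ suc r
      ≡⟨ cong (suc r ℕ.+_) (ℕP.+-identityʳ (suc r)) ⟨
    2 ℕ.* suc r  ∎

  eigenfunction-eigen : ∀ γ → ℚ.- ⟦ suc r ⟧ ℚ.* eigenfunction γ ≡ sumℚ (map eigenfunction (neighbours γ))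
  eigenfunction-eigen γ@(z , isV) = begin
    ℚ.- ⟦ suc r ⟧ ℚ.* weight z
      ≡⟨ eigen-equation z (Equivalence.to T-≡ isV) ⟩
    ⟦ neighboursOnA z ⟧ ℚ.- ⟦ neighboursOnB z ⟧
      ≡⟨ cong₂ (λ m n → ⟦ m ⟧ ℚ.- ⟦ n ⟧) neighbours-onA neighbours-onB ⟨
    ⟦ count (onA ∘ proj₁) (neighbours γ) ⟧ ℚ.- ⟦ count (onB ∘ proj₁) (neighbours γ) ⟧
      ≡⟨ sumℚ-χ-χ (onA ∘ proj₁) (onB ∘ proj₁) (neighbours γ) ⟨
    sumℚ (map eigenfunction (neighbours γ))  ∎
    where
    neighbours-onA : count (onA ∘ proj₁) (neighbours γ) ≡ neighboursOnA z
    neighbours-onA = trans (count-filter (λ δ → T? (adjacentᵇ γ δ)) vertices) (count-vertices-onA (adjacent z))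
    neighbours-onB : count (onB ∘ proj₁) (neighbours γ) ≡ neighboursOnB z
    neighbours-onB = trans (count-filter (λ δ → T? (adjacentᵇ γ δ)) vertices) (count-vertices-onB (adjacent z))

-- Imported only here because the statement's _^_ on ℕ would clash with the field power used above.
open import Data.Nat as ℕ using (ℕ; suc; _^_; _≤_)
open import Data.Nat.Primality using (Prime)
open import Data.Integer as ℤ using (+_)
open import Data.Rational as ℚ using (ℚ; 0ℚ; _/_)
open import Data.Rational.Properties using (_≟_)
open import Data.List using (map; filter; length)
open import Data.Product using (∃; _×_)
open import Relation.Nullary using (¬?)
open import Relation.Binary.PropositionalEquality using (_≡_; _≢_)

proposition1 : (q r p n : ℕ) → Prime p → 1 ≤ n → q ≡ p ^ n → q ≡ r ℕ.* r →
    (F : FiniteField q) →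
    let open UnitaryPolarGraph F r in
    ∃ λ (f : Vertex → ℚ) →
      (∃ λ γ → f γ ≢ 0ℚ)
      × (∀ γ → ℚ.- (+ suc r / 1) ℚ.* f γ ≡ sumℚ (map f (neighbours γ)))
      × length (filter (λ γ → ¬? (f γ ≟ 0ℚ)) vertices) ≡ 2 ℕ.* suc r
proposition1 q r _ _ _ _ _ q≡r*r F =
  eigenfunction , eigenfunction-nonzero , eigenfunction-eigen , eigenfunction-support
  where open UnitaryPolarGraphProperties F r q≡r*r
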